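{- Let $a$ and $b$ be coprime positive integers with $a > b \geq 3$ and $a^2+a+b > b^2+ba$. Then \[ R_3\bigl(ax+by=bz\bigr) \geq a^3 + a^2 + (2b+1)a + 1 . \]
   Context: For a linear equation $\mathcal{E}$ in the unknowns $x,y,z$ and a positive integer $k$, the $k$-colour Rado number $R_k(\mathcal{E})$ is the smallest positive integer $n$, if it exists, such that every colouring of $\{1,2,\dots,n\}$ with $k$ colours contains a monochromatic solution to $\mathcal{E}$, i.e. a solution $(x,y,z)$ with $x,y,z\in\{1,\dots,n\}$ (not necessarily distinct) all of the same colour; $R_k(\mathcal{E})=\infty$ if no such $n$ exists. In the paper's notation the equation $ax+by=bz$ is written $\mathcal{E}(3,0;a,b,b)$. -}

module Defs where

open import Data.Nat using (ℕ; _+_; _*_; _≤_)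
open import Data.Fin using (Fin)
open import Data.Product using (∃-syntax; _×_)
open import Relation.Binary.PropositionalEquality using (_≡_)

Eqn : ℕ → ℕ → ℕ → ℕ → ℕ → Set
Eqn a b x y z = a * x + b * y ≡ b * z

InRange : ℕ → ℕ → Set
InRange n x = 1 ≤ x × x ≤ n

-- Every k-colouring of {1,...,n} (colours Fin k) admits a monochromatic
-- solution (x,y,z), not necessarily distinct, with x,y,z ∈ {1,...,n}.
-- (A colouring is given as a function on ℕ; only its values on {1..n} matter.)
RadoProperty : ℕ → ℕ → ℕ → ℕ → Set
RadoProperty a b k n =
  (χ : ℕ → Fin k) →
  ∃[ x ] ∃[ y ] ∃[ z ]
    (InRange n x × InRange n y × InRange n z ×
     χ x ≡ χ y × χ y ≡ χ z × Eqn a b x y z)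

-- R_k(E) ≥ N : every n with the Rado property satisfies N ≤ n.
-- (R_k(E) is the least such n, or ∞ if none exists; this covers both cases.)
RadoNumber≥ : ℕ → ℕ → ℕ → ℕ → Set
RadoNumber≥ a b k N = ∀ n → 1 ≤ n → RadoProperty a b k n → N ≤ n

{-# OPTIONS --safe #-}
-- As a and b are coprime, every solution of a x + b y = b z is (t b, y, a t + y).
-- Let N = a³ + a² + (2b + 1)a and colour {1, …, N}: red on the top block
-- (N − ab, N], on the multiples of b² up to ab² and on the non-multiples of b up
-- to ab; blue on the remaining multiples of b up to b(a² + a); green elsewhere.
-- A blue x = t b forces b ∣ t, hence t ≥ (a + 1)b, and a green one t > a² + a;
-- either way z = a t + y overshoots its class. A red x = t b cannot lie in the top
-- block (that would give b z > b N, as a > b), so x = s b² with s ≤ a; then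
-- b² + ab < a² + a + b keeps z below the top block unless y is in it, and
-- divisibility by b and b² excludes the remaining combinations.
module Submission where

open import Defs
open import Data.Nat using (ℕ; _+_; _*_; _^_; _≤_; _<_)
open import Data.Nat.Coprimality using (Coprime; coprime-divisor)
import Data.Nat.Coprimality as Coprime
open import Data.Nat.Base using (suc; NonZero; >-nonZero; s≤s; z≤n)
open import Data.Nat.Properties
open import Data.Nat.Divisibility
open import Data.Nat.Tactic.RingSolver using (solve)
open import Data.Fin as Fin using (Fin)
open import Data.List using (_∷_; [])
open import Data.Product using (∃-syntax; _×_; _,_)
open import Data.Sum using (_⊎_; inj₁; inj₂)
open import Relation.Nullary using (¬_; yes; no; contradiction)
open import Relation.Nullary.Decidable using (_×-dec_)
open import Relation.Binary.PropositionalEquality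
  using (_≡_; refl; sym; subst; module ≡-Reasoning)

private
  variable
    m s t y : ℕ

pattern red   = Fin.zero
pattern blue  = Fin.suc Fin.zero
pattern green = Fin.suc (Fin.suc Fin.zero)

∣m+n∣n⇒∣m : ∀ {d m n} → d ∣ m + n → d ∣ n → d ∣ m
∣m+n∣n⇒∣m {d} {m} {n} d∣m+n = ∣m+n∣m⇒∣n (subst (d ∣_) (+-comm m n) d∣m+n)

coprime-∣-cancel : ∀ {a b t y} → Coprime a b → b ∣ a * t + y → b ∣ y → b ∣ t
coprime-∣-cancel coprime b∣at+y b∣y =
  coprime-divisor (Coprime.sym coprime) (∣m+n∣n⇒∣m b∣at+y b∣y)

solution-shape : ∀ {a b x y z} .{{_ : NonZero b}} → Coprime a b →
                 a * x + b * y ≡ b * z → ∃[ t ] x ≡ t * b × z ≡ a * t + y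
solution-shape {a} {b} {x} {y} {z} coprime eq
  with coprime-∣-cancel coprime (subst (b ∣_) (sym eq) (m∣m*n z)) (m∣m*n y)
... | divides t refl = t , refl , *-cancelˡ-≡ z (a * t + y) b (begin
  b * z               ≡⟨ sym eq ⟩
  a * (t * b) + b * y ≡⟨ solve (a ∷ b ∷ t ∷ y ∷ []) ⟩
  b * (a * t + y)     ∎)
  where open ≡-Reasoning

module Colouring (a b : ℕ) .{{_ : NonZero b}} (coprime : Coprime a b) (b<a : b < a)
                 (hyp : b ^ 2 + b * a < a ^ 2 + a + b) where

  N : ℕ
  N = a ^ 3 + a ^ 2 + (2 * b + 1) * a

  -- Upper m says that m lies in the top block (N − a b, N].
  Upper Square Low : ℕ → Set
  Upper m  = N < m + a * b
  Square m = b * b ∣ m × m ≤ a * (b * b)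
  Low m    = ¬ b ∣ m × m ≤ a * b

  Red Blue Green : ℕ → Set
  Red m   = Upper m ⊎ Square m ⊎ Low m
  Blue m  = b ∣ m × m ≤ a * (a * b) + a * b × ¬ Square m
  Green m = m + a * b ≤ N × a * b < m × (b ∣ m → a * (a * b) + a * b < m)

  Coloured : Fin 3 → ℕ → Set
  Coloured red   = Red
  Coloured blue  = Blue
  Coloured green = Green

  colour : ℕ → Fin 3
  colour m with N <? m + a * b | b ∣? m | b * b ∣? m ×-dec m ≤? a * (b * b)
              | m ≤? a * (a * b) + a * b | m ≤? a * b
  ... | yes _ | _     | _     | _     | _     = red
  ... | no _  | yes _ | yes _ | _     | _     = red
  ... | no _  | yes _ | no _  | yes _ | _     = blue
  ... | no _  | yes _ | no _  | no _  | _     = green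
  ... | no _  | no _  | _     | _     | yes _ = red
  ... | no _  | no _  | _     | _     | no _  = green

  colour-spec : ∀ m → Coloured (colour m) m
  colour-spec m with N <? m + a * b | b ∣? m | b * b ∣? m ×-dec m ≤? a * (b * b)
                   | m ≤? a * (a * b) + a * b | m ≤? a * b
  ... | yes up  | _        | _      | _     | _     = inj₁ up
  ... | no _    | yes _    | yes sq | _     | _     = inj₂ (inj₁ sq)
  ... | no _    | yes b∣m  | no ¬sq | yes le | _    = b∣m , le , ¬sq
  ... | no ¬up  | yes _    | no _   | no gt | _     =
    ≮⇒≥ ¬up , ≤-<-trans (m≤n+m (a * b) (a * (a * b))) (≰⇒> gt) , λ _ → ≰⇒> gt
  ... | no _    | no ¬b∣m  | _      | _     | yes le = inj₂ (inj₂ (¬b∣m , le))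
  ... | no ¬up  | no ¬b∣m  | _      | _     | no gt  =
    ≮⇒≥ ¬up , ≰⇒> gt , λ b∣m → contradiction b∣m ¬b∣m

  open ≤-Reasoning

  -- a ^ k unfolds to a * (⋯ * (a * 1)), the form the ring solver can read.
  a²b+ab²+ab≤N : a * (a * b) + a * (b * b) + a * b ≤ N
  a²b+ab²+ab≤N = begin
    a * (a * b) + a * (b * b) + a * b ≡⟨ solve (a ∷ b ∷ []) ⟩
    a * (b * (b * 1) + b * a + b)     ≤⟨ *-monoʳ-≤ a (+-monoˡ-≤ b (<⇒≤ hyp)) ⟩
    a * (a * (a * 1) + a + b + b)     ≤⟨ m≤m+n _ a ⟩
    a * (a * (a * 1) + a + b + b) + a ≡⟨ solve (a ∷ b ∷ []) ⟩
    a * (a * (a * 1)) + a * (a * 1) + (2 * b + 1) * a ∎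

  ≤a²b+ab²⇒¬Upper : m ≤ a * (a * b) + a * (b * b) → ¬ Upper m
  ≤a²b+ab²⇒¬Upper m≤ m∈Upper =
    <⇒≱ m∈Upper (≤-trans (+-monoˡ-≤ (a * b) m≤) a²b+ab²+ab≤N)

  upper-not-multiple : 1 ≤ y → a * t + y ≤ N → ¬ Upper (t * b)
  upper-not-multiple {t = t} y≥1 z≤N x∈Upper = <-irrefl refl (begin-strict
    a * suc N                 ≤⟨ *-monoʳ-≤ a x∈Upper ⟩
    a * (t * b + a * b)       ≡⟨ solve (a ∷ b ∷ t ∷ []) ⟩
    b * (a * t) + a * (a * b) <⟨ +-mono-<-≤ (*-monoʳ-< b at<N) a[ab]≤N ⟩
    b * N + N                 ≡⟨ +-comm (b * N) N ⟩
    suc b * N                 ≤⟨ *-monoˡ-≤ N b<a ⟩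
    a * N                     ≤⟨ m≤n+m (a * N) a ⟩
    a + a * N                 ≡⟨ sym (*-suc a N) ⟩
    a * suc N                 ∎)
    where
    at<N : a * t < N
    at<N = <-≤-trans (m<m+n (a * t) y≥1) z≤N
    a[ab]≤N : a * (a * b) ≤ N
    a[ab]≤N = ≤-trans (≤-trans (m≤m+n _ _) (m≤m+n _ _)) a²b+ab²+ab≤N

  a*m<a*n+y : ∀ {m n} → m ≤ n → 1 ≤ y → a * m < a * n + y
  a*m<a*n+y {n = n} m≤n y≥1 = ≤-<-trans (*-monoʳ-≤ a m≤n) (m<m+n (a * n) y≥1)

  Square⊎Low⇒≤ab² : Square m ⊎ Low m → m ≤ a * (b * b)
  Square⊎Low⇒≤ab² (inj₁ (_ , m≤)) = m≤
  Square⊎Low⇒≤ab² (inj₂ (_ , m≤)) = ≤-trans m≤ (*-monoʳ-≤ a (m≤m*n b b))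

  b²∣a[sb]⇒b∣s : b * b ∣ a * (s * b) → b ∣ s
  b²∣a[sb]⇒b∣s {s} b²∣a[sb] = coprime-divisor (Coprime.sym coprime)
    (*-cancelʳ-∣ b (subst (b * b ∣_) (sym (*-assoc a s b)) b²∣a[sb]))

  no-red-square : .{{_ : NonZero s}} → s ≤ a → 1 ≤ y → a * (s * b) + y ≤ N →
                  Red y → ¬ Red (a * (s * b) + y)
  no-red-square {s} _ y≥1 _ _ (inj₂ (inj₂ (_ , z≤ab))) =
    <⇒≱ (a*m<a*n+y (m≤n*m b s) y≥1) z≤ab
  no-red-square {s} {y} _ _ z≤N (inj₁ y∈Upper) (inj₁ _) = <⇒≱ (begin-strict
    N               <⟨ y∈Upper ⟩
    y + a * b       ≤⟨ +-monoʳ-≤ y (*-monoʳ-≤ a (m≤n*m b s)) ⟩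
    y + a * (s * b) ≡⟨ +-comm y (a * (s * b)) ⟩
    a * (s * b) + y ∎) z≤N
  no-red-square s≤a _ _ (inj₂ y∈Square⊎Low) (inj₁ z∈Upper) =
    ≤a²b+ab²⇒¬Upper
      (+-mono-≤ (*-monoʳ-≤ a (*-monoˡ-≤ b s≤a)) (Square⊎Low⇒≤ab² y∈Square⊎Low)) z∈Upper
  no-red-square {s} {y} _ _ _ (inj₁ y∈Upper) (inj₂ (inj₁ (_ , z≤))) =
    ≤a²b+ab²⇒¬Upper
      (≤-trans (m≤n+m y (a * (s * b))) (≤-trans z≤ (m≤n+m _ _))) y∈Upper
  no-red-square {s} _ y≥1 _ (inj₂ (inj₁ (b²∣y , _))) (inj₂ (inj₁ (b²∣z , z≤)))
    with b²∣a[sb]⇒b∣s {s} (∣m+n∣n⇒∣m b²∣z b²∣y)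
  ... | divides w refl =
    <⇒≱ (a*m<a*n+y (*-monoˡ-≤ b (m≤n*m b w {{m*n≢0⇒m≢0 w}})) y≥1) z≤
  no-red-square {s} _ _ _ (inj₂ (inj₂ (b∤y , _))) (inj₂ (inj₁ (b²∣z , _))) =
    b∤y (∣m+n∣m⇒∣n (∣-trans (m∣m*n b) b²∣z) (∣n⇒∣m*n a (n∣m*n s)))

  no-red-solution : .{{_ : NonZero t}} → 1 ≤ y → a * t + y ≤ N →
                    Red (t * b) → Red y → ¬ Red (a * t + y)
  no-red-solution y≥1 z≤N (inj₁ x∈Upper) _ _ = upper-not-multiple y≥1 z≤N x∈Upper
  no-red-solution {t} _ _ (inj₂ (inj₂ (b∤x , _))) _ _ = b∤x (n∣m*n t)
  no-red-solution {t} y≥1 z≤N (inj₂ (inj₁ (b²∣x , x≤)))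
    with *-cancelʳ-∣ {b} {t} b b²∣x
  ... | divides s refl = no-red-square {{m*n≢0⇒m≢0 s}} s≤a y≥1 z≤N
    where
    s≤a : s ≤ a
    s≤a = *-cancelʳ-≤ s a (b * b) {{m*n≢0 b b}}
            (subst (_≤ a * (b * b)) (*-assoc s b b) x≤)

  no-blue-solution : 1 ≤ y → Blue (t * b) → Blue y → ¬ Blue (a * t + y)
  no-blue-solution {y} y≥1 (_ , _ , x∉Square) (b∣y , _ , _) (b∣z , z≤ , _)
    with coprime-∣-cancel coprime b∣z b∣y
  ... | divides s refl = <⇒≱ (begin-strict
    a * (a * b) + a * b ≡⟨ solve (a ∷ b ∷ []) ⟩
    a * ((1 + a) * b)   <⟨ a*m<a*n+y (*-monoˡ-≤ b a<s) y≥1 ⟩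
    a * (s * b) + y     ∎) z≤
    where
    a<s : a < s
    a<s = *-cancelʳ-< (b * b) a s (subst (a * (b * b) <_) (*-assoc s b b)
            (≰⇒> λ x≤ → x∉Square (divides s (*-assoc s b b) , x≤)))

  no-green-solution : Green (t * b) → Green y → ¬ Green (a * t + y)
  no-green-solution {t} {y} (_ , _ , x-large) (_ , ab<y , _) (z+ab≤N , _ , _) =
    <⇒≱ (begin-strict
      a * (a * (a * 1)) + a * (a * 1) + (2 * b + 1) * a ≡⟨ solve (a ∷ b ∷ []) ⟩
      a * (1 + (a * a + a)) + (a * b + a * b)
        <⟨ +-mono-≤-< (*-monoʳ-≤ a a²+a<t) (+-monoˡ-< (a * b) ab<y) ⟩
      a * t + (y + a * b)                     ≡⟨ sym (+-assoc (a * t) y (a * b)) ⟩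
      a * t + y + a * b                       ∎) z+ab≤N
    where
    a²+a<t : a * a + a < t
    a²+a<t = *-cancelʳ-< b (a * a + a) t (begin-strict
      (a * a + a) * b     ≡⟨ solve (a ∷ b ∷ []) ⟩
      a * (a * b) + a * b <⟨ x-large (n∣m*n t) ⟩
      t * b               ∎)

  no-monochromatic-solution : ∀ c → .{{_ : NonZero t}} → 1 ≤ y → a * t + y ≤ N →
                              Coloured c (t * b) → Coloured c y → ¬ Coloured c (a * t + y)
  no-monochromatic-solution red         = no-red-solution
  no-monochromatic-solution blue  y≥1 _ = no-blue-solution y≥1
  no-monochromatic-solution green _   _ = no-green-solution

  colouring-refutes : ∀ {n} → n ≤ N → ¬ RadoProperty a b 3 n
  colouring-refutes n≤N rado with rado colour
  ... | x , y , z , (x≥1 , _) , (y≥1 , _) , (_ , z≤) , cx≡cy , cy≡cz , eq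
    with solution-shape coprime eq
  ... | t , refl , refl =
    no-monochromatic-solution (colour y) {{m*n≢0⇒m≢0 t {{>-nonZero x≥1}}}}
      y≥1 (≤-trans z≤ n≤N) (coloured cx≡cy) (colour-spec y) (coloured (sym cy≡cz))
    where
    coloured : ∀ {m c} → colour m ≡ c → Coloured c m
    coloured {m} refl = colour-spec m

theorem3 : (a b : ℕ) → Coprime a b → 3 ≤ b → b < a →
           b ^ 2 + b * a < a ^ 2 + a + b →
           RadoNumber≥ a b 3 (a ^ 3 + a ^ 2 + (2 * b + 1) * a + 1)
theorem3 a b coprime 3≤b b<a hyp n _ rado =
  subst (_≤ n) (+-comm 1 N) (≮⇒≥ λ n<1+N → colouring-refutes (m<1+n⇒m≤n n<1+N) rado)
  where
  open Colouring a b {{>-nonZero (<-≤-trans (s≤s z≤n) 3≤b)}} coprime b<a hyp
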